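{- For a positive integer $a_3$, the triple $(3,3,a_3)$ is perfect if and only if $a_3\neq 2$.
   Context: For a graph $G$, the $3$-neighbour bootstrap process starts from a set $A_0\subseteq V(G)$ and, for $t\ge1$, sets $A_t=A_{t-1}\cup\{v: |N_G(v)\cap A_{t-1}|\ge 3\}$; $A_0$ percolates if $\bigcup_t A_t=V(G)$. For positive integers $a_1,a_2,a_3$, $[a_1]\times[a_2]\times[a_3]$ denotes the grid graph (vertices adjacent iff they differ by exactly 1 in exactly one coordinate), and $m(a_1,a_2,a_3;3)$ is the minimum size of a percolating set for the $3$-neighbour process in it. A triple $(a_1,a_2,a_3)$ of positive integers is called perfect if $a_1a_2+a_1a_3+a_2a_3\equiv 0\pmod 3$ and $m(a_1,a_2,a_3;3)=\frac{a_1a_2+a_1a_3+a_2a_3}{3}$. -}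

module Defs where

open import Data.Nat using (ℕ; zero; suc; _+_; _*_; _≤_; _≤ᵇ_; ∣_-_∣; _%_)
open import Data.Nat.Base using () renaming (_≡ᵇ_ to _==_)
open import Data.Bool using (Bool; true; false; _∧_; _∨_)
open import Data.Fin using (Fin; toℕ)
open import Data.List using (List; length; map; concatMap; filterᵇ; allFin)
open import Data.Product using (_×_; _,_; Σ; ∃)
open import Function.Base using (_∘_)
open import Relation.Binary.PropositionalEquality using (_≡_)

-- Vertices of the grid graph [a1] × [a2] × [a3]
-- (coordinates are Fin aᵢ, i.e. {0,…,aᵢ-1}, a shift of {1,…,aᵢ}).
Vertex : ℕ → ℕ → ℕ → Set
Vertex a₁ a₂ a₃ = Fin a₁ × Fin a₂ × Fin a₃

vertices : (a₁ a₂ a₃ : ℕ) → List (Vertex a₁ a₂ a₃)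
vertices a₁ a₂ a₃ =
  concatMap (λ x → concatMap (λ y → map (λ z → (x , y , z)) (allFin a₃)) (allFin a₂)) (allFin a₁)

adj : ∀ {a₁ a₂ a₃} → Vertex a₁ a₂ a₃ → Vertex a₁ a₂ a₃ → Bool
adj (x₁ , x₂ , x₃) (y₁ , y₂ , y₃) =
  ((d₁ == 1) ∧ (d₂ == 0) ∧ (d₃ == 0)) ∨
  ((d₁ == 0) ∧ (d₂ == 1) ∧ (d₃ == 0)) ∨
  ((d₁ == 0) ∧ (d₂ == 0) ∧ (d₃ == 1))
  where
  d₁ = ∣ toℕ x₁ - toℕ y₁ ∣
  d₂ = ∣ toℕ x₂ - toℕ y₂ ∣
  d₃ = ∣ toℕ x₃ - toℕ y₃ ∣

VSet : ℕ → ℕ → ℕ → Set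
VSet a₁ a₂ a₃ = Vertex a₁ a₂ a₃ → Bool

size : ∀ {a₁ a₂ a₃} → VSet a₁ a₂ a₃ → ℕ
size {a₁} {a₂} {a₃} A = length (filterᵇ A (vertices a₁ a₂ a₃))

nbrsIn : ∀ {a₁ a₂ a₃} → VSet a₁ a₂ a₃ → Vertex a₁ a₂ a₃ → ℕ
nbrsIn {a₁} {a₂} {a₃} A v =
  length (filterᵇ (λ u → adj u v ∧ A u) (vertices a₁ a₂ a₃))

step : ∀ {a₁ a₂ a₃} → VSet a₁ a₂ a₃ → VSet a₁ a₂ a₃
step A v = A v ∨ (3 ≤ᵇ nbrsIn A v)

stage : ∀ {a₁ a₂ a₃} → ℕ → VSet a₁ a₂ a₃ → VSet a₁ a₂ a₃
stage zero    A = A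
stage (suc t) A = step (stage t A)

Percolates : ∀ {a₁ a₂ a₃} → VSet a₁ a₂ a₃ → Set
Percolates {a₁} {a₂} {a₃} A = (v : Vertex a₁ a₂ a₃) → ∃ λ t → stage t A v ≡ true

IsMinPercSize : (a₁ a₂ a₃ : ℕ) → ℕ → Set
IsMinPercSize a₁ a₂ a₃ k =
  (Σ (VSet a₁ a₂ a₃) λ A → Percolates A × size A ≡ k) ×
  ((A : VSet a₁ a₂ a₃) → Percolates A → k ≤ size A)

σ₂ : ℕ → ℕ → ℕ → ℕ
σ₂ a₁ a₂ a₃ = a₁ * a₂ + a₁ * a₃ + a₂ * a₃

-- (a₁,a₂,a₃) is perfect: 3 ∣ σ₂ and m(a₁,a₂,a₃;3) = σ₂ / 3
-- (stated as: m = k for some k with 3 * k = σ₂).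
Perfect : ℕ → ℕ → ℕ → Set
Perfect a₁ a₂ a₃ =
  σ₂ a₁ a₂ a₃ % 3 ≡ 0 ×
  (Σ ℕ λ k → 3 * k ≡ σ₂ a₁ a₂ a₃ × IsMinPercSize a₁ a₂ a₃ k)

{-# OPTIONS --safe #-}

-- A vertex joining the infected set X has at least three neighbours in X, so the surface area
-- 6|X| − 2e(X) never increases; the whole box has surface area 2σ₂, so a percolating set A satisfies
-- 2σ₂ + 2e(A) ≤ 6|A|. In [3] × [3] × [2] a percolating set of size σ₂/3 = 7 would therefore be independent.
-- But a percolating set meets every closed set (a set whose vertices have at most two neighbours outside
-- it): the four vertical corner pairs, and on each side face closed rows which, by independence, force a
-- vertex into the middle vertical pair; these eight pairs are disjoint.
-- For a₃ ≠ 2 the bound is attained by the corners of the bottom layer, the diagonal of the top layer and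
-- two opposite side midpoints in each layer in between, alternating in direction: the centre column is
-- infected from the top down, then the layers from the bottom up.

module Submission where

open import Defs
open import Data.Bool using (Bool; true; false; _∧_; _∨_; not; T; T?)
open import Data.Bool.ListAction using (any)
open import Data.Bool.Properties using (T-≡; ∨-zeroʳ)
open import Data.Fin using (Fin; toℕ; fromℕ<)
import Data.Fin as Fin
open import Data.Fin.Properties using (toℕ-fromℕ<; fromℕ<-toℕ; toℕ<n)
open import Data.List using (List; []; _∷_; _++_; length; map; concat; concatMap; filterᵇ; allFin; tabulate)
open import Data.List.Membership.Propositional using (_∈_)
open import Data.List.Membership.Propositional.Properties using (∈-concat⁺′; ∈-map⁺; ∈-tabulate⁺; ∈-filter⁺)
open import Data.List.Properties using (length-tabulate)
open import Data.List.Relation.Unary.All using (All; []; _∷_; lookup; all?)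
import Data.List.Relation.Unary.All as All
open import Data.List.Relation.Unary.Any using (here; there)
open import Data.Nat using (ℕ; zero; suc; _+_; _*_; _∸_; _%_; _≤_; _<_; _≤ᵇ_; _≤?_; z≤n; s≤s; _⊔_; ∣_-_∣; NonZero)
open import Data.Nat.Base using () renaming (_≡ᵇ_ to _==_)
open import Data.Nat.DivMod using (m*n%n≡0)
open import Data.Nat.Properties
open import Data.Nat.Tactic.RingSolver using (solve-∀)
open import Data.Product using (_×_; _,_; ∃; proj₁; proj₂)
open import Data.Product.Properties using () renaming (≡-dec to ×-≡-dec)
open import Data.Sum using (_⊎_; inj₁; inj₂)
open import Function.Base using (_∘_; id)
open import Function.Bundles using (Equivalence; _⇔_; mk⇔)
open import Relation.Binary.Definitions using (DecidableEquality)
open import Relation.Binary.PropositionalEquality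
open import Relation.Nullary using (Dec; yes; no; does; contradiction)
open import Relation.Nullary.Decidable using (True; toWitness)

∑ : {A : Set} → (A → ℕ) → List A → ℕ
∑ f []       = 0
∑ f (x ∷ xs) = f x + ∑ f xs

module _ {A : Set} where

  ∑-cong : ∀ {f g : A → ℕ} xs → (∀ x → f x ≡ g x) → ∑ f xs ≡ ∑ g xs
  ∑-cong []       f≗g = refl
  ∑-cong (x ∷ xs) f≗g = cong₂ _+_ (f≗g x) (∑-cong xs f≗g)

  ∑-mono-≤ : ∀ {f g : A → ℕ} xs → (∀ x → f x ≤ g x) → ∑ f xs ≤ ∑ g xs
  ∑-mono-≤ []       f≤g = z≤n
  ∑-mono-≤ (x ∷ xs) f≤g = +-mono-≤ (f≤g x) (∑-mono-≤ xs f≤g)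

  ∑-+ : ∀ (f g : A → ℕ) xs → ∑ (λ x → f x + g x) xs ≡ ∑ f xs + ∑ g xs
  ∑-+ f g []       = refl
  ∑-+ f g (x ∷ xs) = begin
    f x + g x + ∑ (λ x → f x + g x) xs ≡⟨ cong (f x + g x +_) (∑-+ f g xs) ⟩
    f x + g x + (∑ f xs + ∑ g xs)      ≡⟨ +-exchange (f x) (g x) (∑ f xs) (∑ g xs) ⟩
    f x + ∑ f xs + (g x + ∑ g xs)      ∎
    where
    open ≡-Reasoning
    +-exchange : ∀ a b c d → a + b + (c + d) ≡ a + c + (b + d)
    +-exchange = solve-∀

  ∑-*ˡ : ∀ c (f : A → ℕ) xs → ∑ (λ x → c * f x) xs ≡ c * ∑ f xs
  ∑-*ˡ c f []       = sym (*-zeroʳ c)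
  ∑-*ˡ c f (x ∷ xs) = trans (cong (c * f x +_) (∑-*ˡ c f xs)) (sym (*-distribˡ-+ c (f x) (∑ f xs)))

  ∑-*ʳ : ∀ c (f : A → ℕ) xs → ∑ (λ x → f x * c) xs ≡ ∑ f xs * c
  ∑-*ʳ c f xs = begin
    ∑ (λ x → f x * c) xs ≡⟨ ∑-cong xs (λ x → *-comm (f x) c) ⟩
    ∑ (λ x → c * f x) xs ≡⟨ ∑-*ˡ c f xs ⟩
    c * ∑ f xs           ≡⟨ *-comm c (∑ f xs) ⟩
    ∑ f xs * c           ∎
    where open ≡-Reasoning

  ∑-++ : ∀ (f : A → ℕ) xs ys → ∑ f (xs ++ ys) ≡ ∑ f xs + ∑ f ys
  ∑-++ f []       ys = refl
  ∑-++ f (x ∷ xs) ys = trans (cong (f x +_) (∑-++ f xs ys)) (sym (+-assoc (f x) (∑ f xs) (∑ f ys)))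

  ∑-zero : ∀ xs → ∑ (λ (_ : A) → 0) xs ≡ 0
  ∑-zero []       = refl
  ∑-zero (x ∷ xs) = ∑-zero xs

  ∑-one : ∀ xs → ∑ (λ (_ : A) → 1) xs ≡ length xs
  ∑-one []       = refl
  ∑-one (x ∷ xs) = cong suc (∑-one xs)

  ∑-member : ∀ (f : A → ℕ) {x xs} → x ∈ xs → f x ≤ ∑ f xs
  ∑-member f {xs = y ∷ ys} (here refl) = m≤m+n (f y) (∑ f ys)
  ∑-member f {xs = y ∷ ys} (there x∈)  = ≤-trans (∑-member f x∈) (m≤n+m (∑ f ys) (f y))

∑-swap : ∀ {A B : Set} (h : A → B → ℕ) xs ys →
         ∑ (λ x → ∑ (h x) ys) xs ≡ ∑ (λ y → ∑ (λ x → h x y) xs) ys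
∑-swap h []       ys = sym (∑-zero ys)
∑-swap h (x ∷ xs) ys = trans (cong (∑ (h x) ys +_) (∑-swap h xs ys))
                             (sym (∑-+ (h x) (λ y → ∑ (λ x → h x y) xs) ys))

∑-map : ∀ {A B : Set} (f : B → ℕ) (g : A → B) xs → ∑ f (map g xs) ≡ ∑ (f ∘ g) xs
∑-map f g []       = refl
∑-map f g (x ∷ xs) = cong (f (g x) +_) (∑-map f g xs)

∑-concatMap : ∀ {A B : Set} (f : B → ℕ) (g : A → List B) xs →
              ∑ f (concatMap g xs) ≡ ∑ (λ x → ∑ f (g x)) xs
∑-concatMap f g []       = refl
∑-concatMap f g (x ∷ xs) = trans (∑-++ f (g x) (concat (map g xs)))
                                 (cong (∑ f (g x) +_) (∑-concatMap f g xs))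

∑-tabulate : ∀ {A : Set} n (f : A → ℕ) (g : Fin n → A) → ∑ f (tabulate g) ≡ ∑ (f ∘ g) (allFin n)
∑-tabulate zero    f g = refl
∑-tabulate (suc n) f g = cong (f (g Fin.zero) +_)
  (trans (∑-tabulate n f (g ∘ Fin.suc)) (sym (∑-tabulate n (f ∘ g) Fin.suc)))

∑-allFin-suc : ∀ n (f : Fin (suc n) → ℕ) → ∑ f (allFin (suc n)) ≡ f Fin.zero + ∑ (f ∘ Fin.suc) (allFin n)
∑-allFin-suc n f = cong (f Fin.zero +_) (∑-tabulate n f Fin.suc)

∈-remove : ∀ {A : Set} {x : A} {xs} → x ∈ xs →
           ∃ λ ys → length xs ≡ suc (length ys) × (∀ {w} → w ∈ xs → w ≢ x → w ∈ ys)
∈-remove {xs = x ∷ xs} (here refl) = xs , refl , λ where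
  (here refl) w≢x → contradiction refl w≢x
  (there w∈)  _   → w∈
∈-remove {xs = y ∷ xs} (there x∈) =
  let ys , len , keep = ∈-remove x∈
  in y ∷ ys , cong suc len , λ where
       (here refl) _   → here refl
       (there w∈)  w≢x → there (keep w∈ w≢x)

three-members : ∀ {A : Set} {a b c : A} {xs} → a ∈ xs → b ∈ xs → c ∈ xs → a ≢ b → a ≢ c → b ≢ c → 3 ≤ length xs
three-members a∈ b∈ c∈ a≢b a≢c b≢c
  with ys , len₁ , keep₁ ← ∈-remove a∈
  with zs , len₂ , keep₂ ← ∈-remove (keep₁ b∈ (a≢b ∘ sym))
  with _  , len₃ , _     ← ∈-remove (keep₂ (keep₁ c∈ (a≢c ∘ sym)) (b≢c ∘ sym))
  rewrite len₁ | len₂ | len₃ = s≤s (s≤s (s≤s z≤n))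

χ : Bool → ℕ
χ true  = 1
χ false = 0

length-filterᵇ : ∀ {A : Set} (p : A → Bool) xs → length (filterᵇ p xs) ≡ ∑ (χ ∘ p) xs
length-filterᵇ p []       = refl
length-filterᵇ p (x ∷ xs) with p x
... | true  = cong suc (length-filterᵇ p xs)
... | false = length-filterᵇ p xs

any-count : ∀ {A : Set} (p : A → Bool) xs → any p xs ≡ true → 1 ≤ ∑ (χ ∘ p) xs
any-count p (x ∷ xs) hit with p x
... | true  = s≤s z≤n
... | false = any-count p xs hit

any-false : ∀ {A : Set} (p : A → Bool) {xs} → any p xs ≡ false → ∀ {v} → v ∈ xs → p v ≡ false
any-false p {x ∷ xs} none v∈ with p x in px | v∈
... | false | here refl = px
... | false | there v∈′ = any-false p none v∈′

χ-∧ : ∀ a b → χ (a ∧ b) ≡ χ a * χ b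
χ-∧ true  b = sym (+-identityʳ (χ b))
χ-∧ false b = refl

-- Degree sums of paths

δ₀ δ₁ : ℕ → ℕ
δ₀ d = χ (d == 0)
δ₁ d = χ (d == 1)

dist : ∀ {a} → Fin a → Fin a → ℕ
dist i j = ∣ toℕ i - toℕ j ∣

distanceSum : ∀ {a} → (ℕ → ℕ) → Fin a → ℕ
distanceSum {a} g i = ∑ (λ j → g (dist j i)) (allFin a)

pairDistanceSum : (ℕ → ℕ) → ℕ → ℕ
pairDistanceSum g a = ∑ (distanceSum g) (allFin a)

pairDistanceSum-suc : ∀ g a → pairDistanceSum g (suc a) ≡
  g 0 + ∑ (g ∘ suc ∘ toℕ) (allFin a) + (∑ (g ∘ suc ∘ toℕ) (allFin a) + pairDistanceSum g a)
pairDistanceSum-suc g a = begin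
  pairDistanceSum g (suc a)
    ≡⟨ ∑-allFin-suc a _ ⟩
  ∑ (λ j → g ∣ toℕ j - 0 ∣) (allFin (suc a)) + ∑ (λ i → ∑ (λ j → g ∣ toℕ j - suc (toℕ i) ∣) (allFin (suc a))) (allFin a)
    ≡⟨ cong₂ _+_ (∑-allFin-suc a _) (∑-cong (allFin a) (λ i → ∑-allFin-suc a _)) ⟩
  g 0 + S + ∑ (λ i → g (suc (toℕ i)) + ∑ (λ j → g ∣ toℕ j - toℕ i ∣) (allFin a)) (allFin a)
    ≡⟨ cong (g 0 + S +_) (∑-+ _ _ (allFin a)) ⟩
  g 0 + S + (S + pairDistanceSum g a) ∎
  where
  open ≡-Reasoning
  S = ∑ (g ∘ suc ∘ toℕ) (allFin a)

pairDistanceSum-δ₀ : ∀ a → pairDistanceSum δ₀ a ≡ a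
pairDistanceSum-δ₀ zero    = refl
pairDistanceSum-δ₀ (suc a) = begin
  pairDistanceSum δ₀ (suc a)                            ≡⟨ pairDistanceSum-suc δ₀ a ⟩
  1 + ∑ (λ _ → 0) (allFin a) + (∑ (λ _ → 0) (allFin a) + pairDistanceSum δ₀ a)
    ≡⟨ cong₂ (λ s s′ → 1 + s + (s′ + pairDistanceSum δ₀ a)) (∑-zero (allFin a)) (∑-zero (allFin a)) ⟩
  suc (pairDistanceSum δ₀ a)                            ≡⟨ cong suc (pairDistanceSum-δ₀ a) ⟩
  suc a                                                 ∎
  where open ≡-Reasoning

-- A path with a vertices has a - 1 edges, each counted from both ends.
pairDistanceSum-δ₁ : ∀ a → .{{NonZero a}} → pairDistanceSum δ₁ a + 2 ≡ 2 * a
pairDistanceSum-δ₁ (suc zero)    = refl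
pairDistanceSum-δ₁ (suc (suc a)) = begin
  pairDistanceSum δ₁ (suc (suc a)) + 2
    ≡⟨ cong (_+ 2) (pairDistanceSum-suc δ₁ (suc a)) ⟩
  0 + S + (S + pairDistanceSum δ₁ (suc a)) + 2
    ≡⟨ cong (λ s → 0 + s + (s + pairDistanceSum δ₁ (suc a)) + 2) S≡1 ⟩
  2 + (pairDistanceSum δ₁ (suc a) + 2)
    ≡⟨ cong (2 +_) (pairDistanceSum-δ₁ (suc a)) ⟩
  2 + 2 * suc a
    ≡⟨ sym (*-distribˡ-+ 2 1 (suc a)) ⟩
  2 * suc (suc a) ∎
  where
  open ≡-Reasoning
  S = ∑ (δ₁ ∘ suc ∘ toℕ) (allFin (suc a))
  S≡1 : S ≡ 1
  S≡1 = trans (∑-allFin-suc a (δ₁ ∘ suc ∘ toℕ)) (cong suc (∑-zero (allFin a)))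

χ-adjacent : ∀ d₁ d₂ d₃ →
  χ (((d₁ == 1) ∧ (d₂ == 0) ∧ (d₃ == 0)) ∨ ((d₁ == 0) ∧ (d₂ == 1) ∧ (d₃ == 0)) ∨ ((d₁ == 0) ∧ (d₂ == 0) ∧ (d₃ == 1)))
  ≡ δ₁ d₁ * δ₀ d₂ * δ₀ d₃ + δ₀ d₁ * δ₁ d₂ * δ₀ d₃ + δ₀ d₁ * δ₀ d₂ * δ₁ d₃
χ-adjacent 0               0               0               = refl
χ-adjacent 0               0               1               = refl
χ-adjacent 0               0               (suc (suc _))   = refl
χ-adjacent 0               1               0               = refl
χ-adjacent 0               1               (suc _)         = refl
χ-adjacent 0               (suc (suc _))   _               = refl
χ-adjacent 1               0               0               = refl
χ-adjacent 1               0               (suc _)         = refl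
χ-adjacent 1               (suc _)         _               = refl
χ-adjacent (suc (suc _))   _               _               = refl

-- Surface area of infected sets

module _ {a₁ a₂ a₃ : ℕ} where

  private
    V  = Vertex a₁ a₂ a₃
    Vs = vertices a₁ a₂ a₃

  ∈-vertices : (v : V) → v ∈ Vs
  ∈-vertices (x , y , z) =
    ∈-concat⁺′ (∈-concat⁺′ (∈-map⁺ (λ z → x , y , z) (∈-tabulate⁺ z)) (∈-map⁺ _ (∈-tabulate⁺ y)))
               (∈-map⁺ _ (∈-tabulate⁺ x))

  adj-sym : (u v : V) → adj u v ≡ adj v u
  adj-sym (x₁ , x₂ , x₃) (y₁ , y₂ , y₃)
    rewrite ∣-∣-comm (toℕ x₁) (toℕ y₁) | ∣-∣-comm (toℕ x₂) (toℕ y₂) | ∣-∣-comm (toℕ x₃) (toℕ y₃) = refl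

  size-∑ : (X : VSet a₁ a₂ a₃) → size X ≡ ∑ (χ ∘ X) Vs
  size-∑ X = length-filterᵇ X Vs

  nbrsIn-∑ : (X : VSet a₁ a₂ a₃) (v : V) → nbrsIn X v ≡ ∑ (λ u → χ (adj u v) * χ (X u)) Vs
  nbrsIn-∑ X v = trans (length-filterᵇ _ Vs) (∑-cong Vs (λ u → χ-∧ (adj u v) (X u)))

  nbrsIn-mono : ∀ {X Y : VSet a₁ a₂ a₃} → (∀ u → X u ≡ true → Y u ≡ true) → ∀ v → nbrsIn X v ≤ nbrsIn Y v
  nbrsIn-mono {X} {Y} X⊆Y v rewrite nbrsIn-∑ X v | nbrsIn-∑ Y v = ∑-mono-≤ Vs (λ u → *-monoʳ-≤ (χ (adj u v)) (χ-mono u))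
    where
    χ-mono : ∀ u → χ (X u) ≤ χ (Y u)
    χ-mono u with X u in Xu
    ... | false = z≤n
    ... | true  rewrite X⊆Y u Xu = ≤-refl

  ∑-adj-sym : ∀ (f g : V → ℕ) →
    ∑ (λ v → f v * ∑ (λ u → χ (adj u v) * g u) Vs) Vs ≡ ∑ (λ u → g u * ∑ (λ v → χ (adj v u) * f v) Vs) Vs
  ∑-adj-sym f g = begin
    ∑ (λ v → f v * ∑ (λ u → χ (adj u v) * g u) Vs) Vs
      ≡⟨ ∑-cong Vs (λ v → sym (∑-*ˡ (f v) _ Vs)) ⟩
    ∑ (λ v → ∑ (λ u → f v * (χ (adj u v) * g u)) Vs) Vs
      ≡⟨ ∑-swap _ Vs Vs ⟩
    ∑ (λ u → ∑ (λ v → f v * (χ (adj u v) * g u)) Vs) Vs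
      ≡⟨ ∑-cong Vs (λ u → ∑-cong Vs (λ v → rearrange (f v) (g u) (adj-sym u v))) ⟩
    ∑ (λ u → ∑ (λ v → g u * (χ (adj v u) * f v)) Vs) Vs
      ≡⟨ ∑-cong Vs (λ u → ∑-*ˡ (g u) _ Vs) ⟩
    ∑ (λ u → g u * ∑ (λ v → χ (adj v u) * f v) Vs) Vs ∎
    where
    open ≡-Reasoning
    rearrange : ∀ a b {p q} → p ≡ q → a * (χ p * b) ≡ b * (χ q * a)
    rearrange a b {p} refl = rotate a b (χ p)
      where
      rotate : ∀ a b c → a * (c * b) ≡ b * (c * a)
      rotate = solve-∀

  inducedDegreeSum : VSet a₁ a₂ a₃ → ℕ
  inducedDegreeSum X = ∑ (λ v → χ (X v) * nbrsIn X v) Vs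

  newlyInfected : VSet a₁ a₂ a₃ → V → ℕ
  newlyInfected X v = χ (not (X v) ∧ (3 ≤ᵇ nbrsIn X v))

  χ-step : ∀ X v → χ (step X v) ≡ χ (X v) + newlyInfected X v
  χ-step X v with X v
  ... | true  = refl
  ... | false = refl

  newlyInfected-threshold : ∀ X v → newlyInfected X v * 3 ≤ newlyInfected X v * nbrsIn X v
  newlyInfected-threshold X v with X v | 3 ≤ᵇ nbrsIn X v in 3≤
  ... | true  | _    = z≤n
  ... | false | false = z≤n
  ... | false | true  = *-monoʳ-≤ 1 (≤ᵇ⇒≤ 3 (nbrsIn X v) (subst T (sym 3≤) _))

  size-step : ∀ X → size (step X) ≡ size X + ∑ (newlyInfected X) Vs
  size-step X = begin
    size (step X)                                 ≡⟨ size-∑ (step X) ⟩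
    ∑ (χ ∘ step X) Vs                             ≡⟨ ∑-cong Vs (χ-step X) ⟩
    ∑ (λ v → χ (X v) + newlyInfected X v) Vs      ≡⟨ ∑-+ (χ ∘ X) (newlyInfected X) Vs ⟩
    ∑ (χ ∘ X) Vs + ∑ (newlyInfected X) Vs         ≡⟨ cong (_+ ∑ (newlyInfected X) Vs) (sym (size-∑ X)) ⟩
    size X + ∑ (newlyInfected X) Vs               ∎
    where open ≡-Reasoning

  nbrsIn-step : ∀ X v → nbrsIn (step X) v ≡ nbrsIn X v + ∑ (λ u → χ (adj u v) * newlyInfected X u) Vs
  nbrsIn-step X v = begin
    nbrsIn (step X) v
      ≡⟨ nbrsIn-∑ (step X) v ⟩
    ∑ (λ u → χ (adj u v) * χ (step X u)) Vs
      ≡⟨ ∑-cong Vs (λ u → trans (cong (χ (adj u v) *_) (χ-step X u)) (*-distribˡ-+ (χ (adj u v)) _ _)) ⟩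
    ∑ (λ u → χ (adj u v) * χ (X u) + χ (adj u v) * newlyInfected X u) Vs
      ≡⟨ ∑-+ _ _ Vs ⟩
    ∑ (λ u → χ (adj u v) * χ (X u)) Vs + ∑ (λ u → χ (adj u v) * newlyInfected X u) Vs
      ≡⟨ cong (_+ ∑ (λ u → χ (adj u v) * newlyInfected X u) Vs) (sym (nbrsIn-∑ X v)) ⟩
    nbrsIn X v + ∑ (λ u → χ (adj u v) * newlyInfected X u) Vs ∎
    where open ≡-Reasoning

  -- Each new vertex has at least three old neighbours, and every such edge is counted from both ends.
  inducedDegreeSum-step : ∀ X → inducedDegreeSum X + 6 * ∑ (newlyInfected X) Vs ≤ inducedDegreeSum (step X)
  inducedDegreeSum-step X = begin
    E + 6 * ∑ b Vs                                        ≡⟨ cong (E +_) (sym (∑-*ˡ 6 b Vs)) ⟩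
    E + ∑ (λ v → 6 * b v) Vs                              ≤⟨ +-monoʳ-≤ E (∑-mono-≤ Vs six≤) ⟩
    E + ∑ (λ v → b v * p v + b v * p v) Vs                ≡⟨ cong (E +_) (∑-+ _ _ Vs) ⟩
    E + (∑ (λ v → b v * p v) Vs + ∑ (λ v → b v * p v) Vs) ≡⟨ cong (λ s → E + (s + ∑ (λ v → b v * p v) Vs)) (sym old-to-new) ⟩
    E + (∑ (λ v → x v * q v) Vs + ∑ (λ v → b v * p v) Vs) ≡⟨ sym (+-assoc E _ _) ⟩
    E + ∑ (λ v → x v * q v) Vs + ∑ (λ v → b v * p v) Vs   ≡⟨ cong (_+ ∑ (λ v → b v * p v) Vs) (sym (∑-+ _ _ Vs)) ⟩
    ∑ (λ v → x v * p v + x v * q v) Vs + ∑ (λ v → b v * p v) Vs ≡⟨ sym (∑-+ _ _ Vs) ⟩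
    ∑ (λ v → x v * p v + x v * q v + b v * p v) Vs        ≤⟨ ∑-mono-≤ Vs pointwise ⟩
    inducedDegreeSum (step X)                             ∎
    where
    open ≤-Reasoning
    E = inducedDegreeSum X
    x b p q : V → ℕ
    x v = χ (X v)
    b   = newlyInfected X
    p   = nbrsIn X
    q v = ∑ (λ u → χ (adj u v) * b u) Vs
    six≤ : ∀ v → 6 * b v ≤ b v * p v + b v * p v
    six≤ v = begin
      6 * b v             ≡⟨ split-six (b v) ⟩
      b v * 3 + b v * 3   ≤⟨ +-mono-≤ (newlyInfected-threshold X v) (newlyInfected-threshold X v) ⟩
      b v * p v + b v * p v ∎
      where
      split-six : ∀ c → 6 * c ≡ c * 3 + c * 3
      split-six = solve-∀
    old-to-new : ∑ (λ v → x v * q v) Vs ≡ ∑ (λ v → b v * p v) Vs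
    old-to-new = trans (∑-adj-sym x b) (∑-cong Vs (λ u → cong (b u *_) (sym (nbrsIn-∑ X u))))
    pointwise : ∀ v → x v * p v + x v * q v + b v * p v ≤ χ (step X v) * nbrsIn (step X) v
    pointwise v rewrite χ-step X v | nbrsIn-step X v = expand (x v) (b v) (p v) (q v)
      where
      expand : ∀ x b p q → x * p + x * q + b * p ≤ (x + b) * (p + q)
      expand x b p q = begin
        x * p + x * q + b * p         ≤⟨ m≤m+n _ (b * q) ⟩
        x * p + x * q + b * p + b * q ≡⟨ distribute x b p q ⟩
        (x + b) * (p + q)             ∎
        where
        distribute : ∀ x b p q → x * p + x * q + b * p + b * q ≡ (x + b) * (p + q)
        distribute = solve-∀

  step-surface : ∀ X → 6 * size (step X) + inducedDegreeSum X ≤ 6 * size X + inducedDegreeSum (step X)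
  step-surface X = begin
    6 * size (step X) + E                 ≡⟨ cong (λ s → 6 * s + E) (size-step X) ⟩
    6 * (size X + ∑ b Vs) + E             ≡⟨ cong (_+ E) (*-distribˡ-+ 6 (size X) (∑ b Vs)) ⟩
    6 * size X + 6 * ∑ b Vs + E           ≡⟨ +-assoc (6 * size X) (6 * ∑ b Vs) E ⟩
    6 * size X + (6 * ∑ b Vs + E)         ≡⟨ cong (6 * size X +_) (+-comm (6 * ∑ b Vs) E) ⟩
    6 * size X + (E + 6 * ∑ b Vs)         ≤⟨ +-monoʳ-≤ (6 * size X) (inducedDegreeSum-step X) ⟩
    6 * size X + inducedDegreeSum (step X) ∎
    where
    open ≤-Reasoning
    E = inducedDegreeSum X
    b = newlyInfected X

  stage-surface : ∀ t A → 6 * size (stage t A) + inducedDegreeSum A ≤ 6 * size A + inducedDegreeSum (stage t A)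
  stage-surface zero    A = ≤-refl
  stage-surface (suc t) A = +-cancelʳ-≤ (6 * size X + E X) _ _ (begin
    6 * size Y + E A + (6 * size X + E X) ≡⟨ exchange-right (6 * size Y) (E A) (6 * size X) (E X) ⟩
    6 * size Y + E X + (6 * size X + E A) ≤⟨ +-mono-≤ (step-surface X) (stage-surface t A) ⟩
    6 * size X + E Y + (6 * size A + E X) ≡⟨ exchange-left (6 * size X) (E Y) (6 * size A) (E X) ⟩
    6 * size A + E Y + (6 * size X + E X) ∎)
    where
    open ≤-Reasoning
    X = stage t A
    Y = step X
    E = inducedDegreeSum
    exchange-right : ∀ p q r s → p + q + (r + s) ≡ p + s + (r + q)
    exchange-right = solve-∀
    exchange-left : ∀ p q r s → p + q + (r + s) ≡ r + q + (p + s)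
    exchange-left = solve-∀

  stage-mono : ∀ (A : VSet a₁ a₂ a₃) (v : V) {t t′} → t ≤ t′ → stage t A v ≡ true → stage t′ A v ≡ true
  stage-mono A v {t′ = zero}   z≤n      infected = infected
  stage-mono A v {t′ = suc t′} t≤1+t′   infected with m≤n⇒m<n∨m≡n t≤1+t′
  ... | inj₂ refl      = infected
  ... | inj₁ (s≤s t≤t′) rewrite stage-mono A v t≤t′ infected = refl

  eventually-full : ∀ {A : VSet a₁ a₂ a₃} → Percolates A → ∃ λ T → ∀ v → stage T A v ≡ true
  eventually-full {A} perc = let T , allT = listed Vs in T , λ v → lookup allT (∈-vertices v)
    where
    listed : ∀ vs → ∃ λ T → All (λ v → stage T A v ≡ true) vs
    listed []       = 0 , []
    listed (v ∷ vs) =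
      let T , allT = listed vs ; t , vt = perc v
      in T ⊔ t , stage-mono A v (m≤n⊔m T t) vt ∷ All.map (λ {u} → stage-mono A u (m≤m⊔n T t)) allT

  size-cong : ∀ {X Y : VSet a₁ a₂ a₃} → (∀ v → X v ≡ Y v) → size X ≡ size Y
  size-cong {X} {Y} X≗Y = trans (size-∑ X) (trans (∑-cong Vs (cong χ ∘ X≗Y)) (sym (size-∑ Y)))

  nbrsIn-cong : ∀ {X Y : VSet a₁ a₂ a₃} → (∀ v → X v ≡ Y v) → ∀ v → nbrsIn X v ≡ nbrsIn Y v
  nbrsIn-cong {X} {Y} X≗Y v = trans (nbrsIn-∑ X v)
    (trans (∑-cong Vs (λ u → cong (λ b → χ (adj u v) * χ b) (X≗Y u))) (sym (nbrsIn-∑ Y v)))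

  inducedDegreeSum-cong : ∀ {X Y : VSet a₁ a₂ a₃} → (∀ v → X v ≡ Y v) → inducedDegreeSum X ≡ inducedDegreeSum Y
  inducedDegreeSum-cong X≗Y = ∑-cong Vs (λ v → cong₂ _*_ (cong χ (X≗Y v)) (nbrsIn-cong X≗Y v))

  full : VSet a₁ a₂ a₃
  full _ = true

  percolating-surface : ∀ {A : VSet a₁ a₂ a₃} → Percolates A →
                        6 * size full + inducedDegreeSum A ≤ 6 * size A + inducedDegreeSum full
  percolating-surface {A} perc =
    let T , allT = eventually-full perc
    in subst₂ (λ s e → 6 * s + inducedDegreeSum A ≤ 6 * size A + e)
              (size-cong allT) (inducedDegreeSum-cong allT) (stage-surface T A)

  ∑-vertices : ∀ (f : V → ℕ) →
    ∑ f Vs ≡ ∑ (λ x → ∑ (λ y → ∑ (λ z → f (x , y , z)) (allFin a₃)) (allFin a₂)) (allFin a₁)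
  ∑-vertices f = trans (∑-concatMap f _ (allFin a₁)) (∑-cong (allFin a₁) (λ x →
    trans (∑-concatMap f _ (allFin a₂)) (∑-cong (allFin a₂) (λ y → ∑-map f _ (allFin a₃)))))

  ∑-vertices-product : ∀ (f : Fin a₁ → ℕ) (g : Fin a₂ → ℕ) (h : Fin a₃ → ℕ) →
    ∑ (λ v → f (proj₁ v) * g (proj₁ (proj₂ v)) * h (proj₂ (proj₂ v))) Vs ≡
    ∑ f (allFin a₁) * ∑ g (allFin a₂) * ∑ h (allFin a₃)
  ∑-vertices-product f g h = begin
    ∑ (λ v → f (proj₁ v) * g (proj₁ (proj₂ v)) * h (proj₂ (proj₂ v))) Vs
      ≡⟨ ∑-vertices _ ⟩
    ∑ (λ x → ∑ (λ y → ∑ (λ z → f x * g y * h z) (allFin a₃)) (allFin a₂)) (allFin a₁)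
      ≡⟨ ∑-cong (allFin a₁) (λ x → ∑-cong (allFin a₂) (λ y → ∑-*ˡ (f x * g y) h (allFin a₃))) ⟩
    ∑ (λ x → ∑ (λ y → f x * g y * H) (allFin a₂)) (allFin a₁)
      ≡⟨ ∑-cong (allFin a₁) (λ x → trans (∑-*ʳ H (λ y → f x * g y) (allFin a₂))
                                         (cong (_* H) (∑-*ˡ (f x) g (allFin a₂)))) ⟩
    ∑ (λ x → f x * G * H) (allFin a₁)
      ≡⟨ trans (∑-*ʳ H (λ x → f x * G) (allFin a₁)) (cong (_* H) (∑-*ʳ G f (allFin a₁))) ⟩
    ∑ f (allFin a₁) * G * H ∎
    where
    open ≡-Reasoning
    G = ∑ g (allFin a₂)
    H = ∑ h (allFin a₃)

  χ-adj : ∀ u (x : Fin a₁) (y : Fin a₂) (z : Fin a₃) → χ (adj u (x , y , z)) ≡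
    δ₁ (dist (proj₁ u) x) * δ₀ (dist (proj₁ (proj₂ u)) y) * δ₀ (dist (proj₂ (proj₂ u)) z) +
    δ₀ (dist (proj₁ u) x) * δ₁ (dist (proj₁ (proj₂ u)) y) * δ₀ (dist (proj₂ (proj₂ u)) z) +
    δ₀ (dist (proj₁ u) x) * δ₀ (dist (proj₁ (proj₂ u)) y) * δ₁ (dist (proj₂ (proj₂ u)) z)
  χ-adj (x′ , y′ , z′) x y z = χ-adjacent (dist x′ x) (dist y′ y) (dist z′ z)

  nbrsIn-full : ∀ x y z → nbrsIn full (x , y , z) ≡
    distanceSum δ₁ x * distanceSum δ₀ y * distanceSum δ₀ z +
    distanceSum δ₀ x * distanceSum δ₁ y * distanceSum δ₀ z +
    distanceSum δ₀ x * distanceSum δ₀ y * distanceSum δ₁ z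
  nbrsIn-full x y z = begin
    nbrsIn full (x , y , z)
      ≡⟨ nbrsIn-∑ full (x , y , z) ⟩
    ∑ (λ u → χ (adj u (x , y , z)) * 1) Vs
      ≡⟨ ∑-cong Vs (λ u → trans (*-identityʳ _) (χ-adj u x y z)) ⟩
    ∑ (λ u → term δ₁ δ₀ δ₀ u + term δ₀ δ₁ δ₀ u + term δ₀ δ₀ δ₁ u) Vs
      ≡⟨ trans (∑-+ _ _ Vs) (cong (_+ ∑ (term δ₀ δ₀ δ₁) Vs) (∑-+ _ _ Vs)) ⟩
    ∑ (term δ₁ δ₀ δ₀) Vs + ∑ (term δ₀ δ₁ δ₀) Vs + ∑ (term δ₀ δ₀ δ₁) Vs
      ≡⟨ cong₂ _+_ (cong₂ _+_ (∑-vertices-product _ _ _) (∑-vertices-product _ _ _)) (∑-vertices-product _ _ _) ⟩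
    distanceSum δ₁ x * distanceSum δ₀ y * distanceSum δ₀ z +
    distanceSum δ₀ x * distanceSum δ₁ y * distanceSum δ₀ z +
    distanceSum δ₀ x * distanceSum δ₀ y * distanceSum δ₁ z ∎
    where
    open ≡-Reasoning
    term : (ℕ → ℕ) → (ℕ → ℕ) → (ℕ → ℕ) → V → ℕ
    term f g h u = f (dist (proj₁ u) x) * g (dist (proj₁ (proj₂ u)) y) * h (dist (proj₂ (proj₂ u)) z)

  inducedDegreeSum-full : inducedDegreeSum full ≡
    pairDistanceSum δ₁ a₁ * pairDistanceSum δ₀ a₂ * pairDistanceSum δ₀ a₃ +
    pairDistanceSum δ₀ a₁ * pairDistanceSum δ₁ a₂ * pairDistanceSum δ₀ a₃ +
    pairDistanceSum δ₀ a₁ * pairDistanceSum δ₀ a₂ * pairDistanceSum δ₁ a₃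
  inducedDegreeSum-full = begin
    inducedDegreeSum full
      ≡⟨ ∑-cong Vs (λ v → *-identityˡ (nbrsIn full v)) ⟩
    ∑ (nbrsIn full) Vs
      ≡⟨ ∑-cong Vs (λ v → nbrsIn-full (proj₁ v) (proj₁ (proj₂ v)) (proj₂ (proj₂ v))) ⟩
    ∑ (λ v → term δ₁ δ₀ δ₀ v + term δ₀ δ₁ δ₀ v + term δ₀ δ₀ δ₁ v) Vs
      ≡⟨ trans (∑-+ _ _ Vs) (cong (_+ ∑ (term δ₀ δ₀ δ₁) Vs) (∑-+ _ _ Vs)) ⟩
    ∑ (term δ₁ δ₀ δ₀) Vs + ∑ (term δ₀ δ₁ δ₀) Vs + ∑ (term δ₀ δ₀ δ₁) Vs
      ≡⟨ cong₂ _+_ (cong₂ _+_ (∑-vertices-product _ _ _) (∑-vertices-product _ _ _)) (∑-vertices-product _ _ _) ⟩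
    pairDistanceSum δ₁ a₁ * pairDistanceSum δ₀ a₂ * pairDistanceSum δ₀ a₃ +
    pairDistanceSum δ₀ a₁ * pairDistanceSum δ₁ a₂ * pairDistanceSum δ₀ a₃ +
    pairDistanceSum δ₀ a₁ * pairDistanceSum δ₀ a₂ * pairDistanceSum δ₁ a₃ ∎
    where
    open ≡-Reasoning
    term : (ℕ → ℕ) → (ℕ → ℕ) → (ℕ → ℕ) → V → ℕ
    term f g h v = distanceSum f (proj₁ v) * distanceSum g (proj₁ (proj₂ v)) * distanceSum h (proj₂ (proj₂ v))

  size-full : size full ≡ a₁ * a₂ * a₃
  size-full = begin
    size full                                                           ≡⟨ size-∑ full ⟩
    ∑ (λ _ → 1 * 1 * 1) Vs                                              ≡⟨ ∑-vertices-product _ _ _ ⟩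
    ∑ (λ _ → 1) (allFin a₁) * ∑ (λ _ → 1) (allFin a₂) * ∑ (λ _ → 1) (allFin a₃)
      ≡⟨ cong₂ _*_ (cong₂ _*_ (count a₁) (count a₂)) (count a₃) ⟩
    a₁ * a₂ * a₃                                                        ∎
    where
    open ≡-Reasoning
    count : ∀ a → ∑ (λ _ → 1) (allFin a) ≡ a
    count a = trans (∑-one (allFin a)) (length-tabulate id)

  box-surface : .{{NonZero a₁}} → .{{NonZero a₂}} → .{{NonZero a₃}} →
                6 * size full ≡ inducedDegreeSum full + 2 * σ₂ a₁ a₂ a₃
  box-surface rewrite size-full | inducedDegreeSum-full
                    | pairDistanceSum-δ₀ a₁ | pairDistanceSum-δ₀ a₂ | pairDistanceSum-δ₀ a₃ =
    surface-identity {a₁} {a₂} {a₃} (pairDistanceSum-δ₁ a₁) (pairDistanceSum-δ₁ a₂) (pairDistanceSum-δ₁ a₃)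
    where
    surface-identity : ∀ {a b c p q r} → p + 2 ≡ 2 * a → q + 2 ≡ 2 * b → r + 2 ≡ 2 * c →
                       6 * (a * b * c) ≡ p * b * c + a * q * c + a * b * r + 2 * (a * b + a * c + b * c)
    surface-identity {a} {b} {c} {p} {q} {r} eqa eqb eqc = begin
      6 * (a * b * c)                                               ≡⟨ spread a b c ⟩
      2 * a * b * c + a * (2 * b) * c + a * b * (2 * c)             ≡⟨ cong₂ _+_ (cong₂ _+_ (cong (λ t → t * b * c) (sym eqa))
                                                                                             (cong (λ t → a * t * c) (sym eqb)))
                                                                                (cong (a * b *_) (sym eqc)) ⟩
      (p + 2) * b * c + a * (q + 2) * c + a * b * (r + 2)           ≡⟨ collect a b c p q r ⟩
      p * b * c + a * q * c + a * b * r + 2 * (a * b + a * c + b * c) ∎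
      where
      open ≡-Reasoning
      spread : ∀ a b c → 6 * (a * b * c) ≡ 2 * a * b * c + a * (2 * b) * c + a * b * (2 * c)
      spread = solve-∀
      collect : ∀ a b c p q r → (p + 2) * b * c + a * (q + 2) * c + a * b * (r + 2) ≡
                                p * b * c + a * q * c + a * b * r + 2 * (a * b + a * c + b * c)
      collect = solve-∀

  percolating-surface-bound : .{{NonZero a₁}} → .{{NonZero a₂}} → .{{NonZero a₃}} → ∀ {A : VSet a₁ a₂ a₃} →
                          Percolates A → 2 * σ₂ a₁ a₂ a₃ + inducedDegreeSum A ≤ 6 * size A
  percolating-surface-bound {A} perc = +-cancelˡ-≤ (inducedDegreeSum full) _ _ (begin
    inducedDegreeSum full + (2 * σ₂ a₁ a₂ a₃ + inducedDegreeSum A)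
      ≡⟨ sym (+-assoc (inducedDegreeSum full) _ _) ⟩
    inducedDegreeSum full + 2 * σ₂ a₁ a₂ a₃ + inducedDegreeSum A
      ≡⟨ cong (_+ inducedDegreeSum A) (sym box-surface) ⟩
    6 * size full + inducedDegreeSum A
      ≤⟨ percolating-surface perc ⟩
    6 * size A + inducedDegreeSum full
      ≡⟨ +-comm (6 * size A) _ ⟩
    inducedDegreeSum full + 6 * size A ∎)
    where open ≤-Reasoning

  percolating-size-bound : .{{NonZero a₁}} → .{{NonZero a₂}} → .{{NonZero a₃}} → ∀ {A : VSet a₁ a₂ a₃} {k} →
                           Percolates A → 3 * k ≡ σ₂ a₁ a₂ a₃ → k ≤ size A
  percolating-size-bound {A} {k} perc 3k≡σ₂ = *-cancelˡ-≤ 6 (begin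
    6 * k                                 ≡⟨ *-assoc 2 3 k ⟩
    2 * (3 * k)                           ≡⟨ cong (2 *_) 3k≡σ₂ ⟩
    2 * σ₂ a₁ a₂ a₃                       ≤⟨ m≤m+n _ (inducedDegreeSum A) ⟩
    2 * σ₂ a₁ a₂ a₃ + inducedDegreeSum A  ≤⟨ percolating-surface-bound perc ⟩
    6 * size A                            ∎)
    where open ≤-Reasoning

  _≟ᵥ_ : DecidableEquality V
  _≟ᵥ_ = ×-≡-dec Fin._≟_ (×-≡-dec Fin._≟_ Fin._≟_)

  open import Data.List.Membership.DecPropositional _≟ᵥ_ using (_∈?_)

  outside : List V → VSet a₁ a₂ a₃
  outside ds u = not (does (u ∈? ds))

  -- Closed sets

  Closed : List V → Set
  Closed ds = All (λ v → nbrsIn (outside ds) v ≤ 2) ds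

  closed? : (ds : List V) → Dec (Closed ds)
  closed? ds = all? (λ v → nbrsIn (outside ds) v ≤? 2) ds

  closed-avoided : ∀ {A : VSet a₁ a₂ a₃} {ds} → Closed ds → (∀ {v} → v ∈ ds → A v ≡ false) →
                   ∀ t {v} → v ∈ ds → stage t A v ≡ false
  closed-avoided closed avoided zero    v∈ = avoided v∈
  closed-avoided {A} {ds} closed avoided (suc t) {v} v∈
    rewrite closed-avoided closed avoided t v∈ =
      below-threshold (≤-trans (nbrsIn-mono infected⇒outside v) (lookup closed v∈))
    where
    infected⇒outside : ∀ u → stage t A u ≡ true → outside ds u ≡ true
    infected⇒outside u infected with u ∈? ds
    ... | no _    = refl
    ... | yes u∈ = contradiction (trans (sym infected) (closed-avoided closed avoided t u∈)) λ ()
    below-threshold : ∀ {n} → n ≤ 2 → (3 ≤ᵇ n) ≡ false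
    below-threshold z≤n             = refl
    below-threshold (s≤s z≤n)       = refl
    below-threshold (s≤s (s≤s z≤n)) = refl

  percolating-meets-closed : ∀ {A : VSet a₁ a₂ a₃} {d ds} → Percolates A → Closed (d ∷ ds) → any A (d ∷ ds) ≡ true
  percolating-meets-closed {A} {d} {ds} perc closed with any A (d ∷ ds) in none
  ... | true  = refl
  ... | false = let t , infected = perc d in
    contradiction (trans (sym infected) (closed-avoided closed (any-false A none) t (here refl))) λ ()

  adjacent-members : ∀ {A : VSet a₁ a₂ a₃} {u v} → A u ≡ true → A v ≡ true → adj u v ≡ true → 1 ≤ inducedDegreeSum A
  adjacent-members {A} {u} {v} Au Av uv = begin
    1                                        ≡⟨ cong₂ (λ a b → χ a * χ b) (sym uv) (sym Au) ⟩
    χ (adj u v) * χ (A u)                    ≤⟨ ∑-member (λ w → χ (adj w v) * χ (A w)) (∈-vertices u) ⟩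
    ∑ (λ w → χ (adj w v) * χ (A w)) Vs       ≡⟨ sym (nbrsIn-∑ A v) ⟩
    nbrsIn A v                               ≡⟨ sym (*-identityˡ (nbrsIn A v)) ⟩
    1 * nbrsIn A v                           ≡⟨ cong (λ b → χ b * nbrsIn A v) (sym Av) ⟩
    χ (A v) * nbrsIn A v                     ≤⟨ ∑-member (λ w → χ (A w) * nbrsIn A w) (∈-vertices v) ⟩
    inducedDegreeSum A                       ∎
    where open ≤-Reasoning

-- Independent percolating sets in [3] × [3] × [2]

pattern lo  = Fin.zero
pattern mid = Fin.suc Fin.zero
pattern hi  = Fin.suc (Fin.suc Fin.zero)

Position : Set
Position = Fin 3 × Fin 3

module _ {n : ℕ} where

  _at_ : Position → Fin n → Vertex 3 3 n
  (x , y) at z = x , y , z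

module IndependentPercolating {A : VSet 3 3 2} (perc : Percolates A) (independent : inducedDegreeSum A ≡ 0) where

  column : Position → List (Vertex 3 3 2)
  column p = p at lo ∷ p at mid ∷ []

  row : Fin 2 → Position → Position → Position → List (Vertex 3 3 2)
  row z p q r = p at z ∷ q at z ∷ r at z ∷ []

  twisted : Fin 2 → Position → Position → Position → List (Vertex 3 3 2)
  twisted z p q r = p at z ∷ q at lo ∷ q at mid ∷ r at opposite z ∷ []
    where
    opposite : Fin 2 → Fin 2
    opposite lo  = mid
    opposite mid = lo

  column-independent : ∀ p → A (p at lo) ∧ A (p at mid) ≡ false
  column-independent (x , y) with A ((x , y) at lo) in Au | A ((x , y) at mid) in Av
  ... | false | _     = refl
  ... | true  | false = refl
  ... | true  | true  = contradiction (subst (1 ≤_) independent (adjacent-members {A = A} Au Av vertical)) λ ()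
    where
    vertical : adj {a₃ = 2} ((x , y) at lo) ((x , y) at mid) ≡ true
    vertical rewrite ∣n-n∣≡0 (toℕ x) | ∣n-n∣≡0 (toℕ y) = refl

  hit : ∀ {d ds} → Closed (d ∷ ds) → any A (d ∷ ds) ≡ true
  hit = percolating-meets-closed perc

  -- The rows and twisted rows of the side face p q r are closed; if they all missed the middle column q,
  -- they would force both vertices of column p or of column r into the set.
  middle-column-hit : ∀ p q r →
    {True (closed? (row lo p q r))} → {True (closed? (row mid p q r))} →
    {True (closed? (twisted mid p q r))} → {True (closed? (twisted lo p q r))} →
    any A (column q) ≡ true
  middle-column-hit p q r {row₀} {row₁} {twist₀} {twist₁} =
    face (A (p at lo)) (A (p at mid)) (A (r at lo)) (A (r at mid)) (A (q at lo)) (A (q at mid))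
         (hit (toWitness row₀)) (hit (toWitness row₁)) (hit (toWitness twist₀)) (hit (toWitness twist₁))
         (column-independent p) (column-independent r)
    where
    face : ∀ a b c d m n → a ∨ m ∨ c ∨ false ≡ true → b ∨ n ∨ d ∨ false ≡ true →
           b ∨ m ∨ n ∨ c ∨ false ≡ true → a ∨ m ∨ n ∨ d ∨ false ≡ true →
           a ∧ b ≡ false → c ∧ d ≡ false → m ∨ n ∨ false ≡ true
    face _     _     _     _     true  _     _  _  _  _  _  _  = refl
    face _     _     _     _     false true  _  _  _  _  _  _  = refl
    face true  true  _     _     false false _  _  _  _  () _
    face true  false _     false false false _  () _  _  _  _
    face true  false false true  false false _  _  () _  _  _
    face true  false true  true  false false _  _  _  _  _  ()
    face false _     false _     false false () _  _  _  _  _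
    face false _     true  false false false _  _  _  () _  _
    face false _     true  true  false false _  _  _  _  _  ()

  corner-column-hit : ∀ p → {True (closed? (column p))} → any A (column p) ≡ true
  corner-column-hit p {closed} = hit (toWitness closed)

  columnCount : Position → ℕ
  columnCount p = ∑ (χ ∘ A) (column p)

  isCentre : Position → Bool
  isCentre (mid , mid) = true
  isCentre _           = false

  column-hit : ∀ x y → χ (not (isCentre (x , y))) ≤ columnCount (x , y)
  column-hit lo  lo  = any-count A (column (lo , lo)) (corner-column-hit (lo , lo))
  column-hit lo  mid = any-count A (column (lo , mid)) (middle-column-hit (lo , lo) (lo , mid) (lo , hi))
  column-hit lo  hi  = any-count A (column (lo , hi)) (corner-column-hit (lo , hi))
  column-hit mid lo  = any-count A (column (mid , lo)) (middle-column-hit (lo , lo) (mid , lo) (hi , lo))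
  column-hit mid mid = z≤n
  column-hit mid hi  = any-count A (column (mid , hi)) (middle-column-hit (lo , hi) (mid , hi) (hi , hi))
  column-hit hi  lo  = any-count A (column (hi , lo)) (corner-column-hit (hi , lo))
  column-hit hi  mid = any-count A (column (hi , mid)) (middle-column-hit (hi , lo) (hi , mid) (hi , hi))
  column-hit hi  hi  = any-count A (column (hi , hi)) (corner-column-hit (hi , hi))

  eight-columns : 8 ≤ size A
  eight-columns = subst (8 ≤_) (sym (trans (size-∑ A) (∑-vertices (χ ∘ A))))
    (∑-mono-≤ (allFin 3) (λ x → ∑-mono-≤ (allFin 3) (column-hit x)))

percolating-3×3×2 : ∀ {A : VSet 3 3 2} → Percolates A → 8 ≤ size A
percolating-3×3×2 {A} perc with 8 ≤? size A
... | yes 8≤size = 8≤size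
... | no  8≰size = IndependentPercolating.eight-columns perc independent
  where
  independent : inducedDegreeSum A ≡ 0
  independent = n≤0⇒n≡0 (+-cancelˡ-≤ 42 _ 0
    (≤-trans (percolating-surface-bound perc) (*-monoʳ-≤ 6 (≤-pred (≰⇒> 8≰size)))))

-- A percolating set of size 2a₃ + 3

module Infection {a₁ a₂ a₃ : ℕ} (A : VSet a₁ a₂ a₃) where

  Infected : Vertex a₁ a₂ a₃ → Set
  Infected v = ∃ λ t → stage t A v ≡ true

  seeded : ∀ {v} → A v ≡ true → Infected v
  seeded Av = 0 , Av

  three-neighbours : ∀ {v u₁ u₂ u₃} → adj u₁ v ≡ true → adj u₂ v ≡ true → adj u₃ v ≡ true →
    u₁ ≢ u₂ → u₁ ≢ u₃ → u₂ ≢ u₃ → Infected u₁ → Infected u₂ → Infected u₃ → Infected v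
  three-neighbours {v} {u₁} {u₂} {u₃} adj₁ adj₂ adj₃ u₁≢u₂ u₁≢u₃ u₂≢u₃ (t₁ , inf₁) (t₂ , inf₂) (t₃ , inf₃) =
    suc t , trans (cong (X v ∨_) (Equivalence.to T-≡ (≤⇒≤ᵇ three))) (∨-zeroʳ (X v))
    where
    t = t₁ ⊔ t₂ ⊔ t₃
    X = stage t A
    counted : ∀ {u s} → adj u v ≡ true → s ≤ t → stage s A u ≡ true →
              u ∈ filterᵇ (λ u → adj u v ∧ X u) (vertices a₁ a₂ a₃)
    counted {u} uv s≤t inf = ∈-filter⁺ (λ w → T? (adj w v ∧ X w)) (∈-vertices u)
      (Equivalence.from T-≡ (cong₂ _∧_ uv (stage-mono A u s≤t inf)))
    three : 3 ≤ nbrsIn X v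
    three = three-members (counted adj₁ (≤-trans (m≤m⊔n t₁ t₂) (m≤m⊔n (t₁ ⊔ t₂) t₃)) inf₁)
                          (counted adj₂ (≤-trans (m≤n⊔m t₁ t₂) (m≤m⊔n (t₁ ⊔ t₂) t₃)) inf₂)
                          (counted adj₃ (m≤n⊔m (t₁ ⊔ t₂) t₃) inf₃)
                          u₁≢u₂ u₁≢u₃ u₂≢u₃

odd : ℕ → Bool
odd zero    = false
odd (suc k) = not (odd k)

isCorner : Position → Bool
isCorner (mid , _) = false
isCorner (_ , mid) = false
isCorner _         = true

isDiagonal : Position → Bool
isDiagonal (x , y) = toℕ x == toℕ y

isSideMiddle : Bool → Position → Bool
isSideMiddle true  (lo  , mid) = true
isSideMiddle true  (hi  , mid) = true
isSideMiddle false (mid , lo)  = true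
isSideMiddle false (mid , hi)  = true
isSideMiddle _     _           = false

layerSeed : (bottom top parity : Bool) → Position → Bool
layerSeed true  top  _      P = isCorner P ∨ (top ∧ isDiagonal P)
layerSeed false true _      P = isDiagonal P
layerSeed false false parity P = isSideMiddle parity P

seed : (n : ℕ) → VSet 3 3 n
seed n (x , y , z) = layerSeed (toℕ z == 0) (suc (toℕ z) == n) (odd (toℕ z)) (x , y)

layerSeed-size : ∀ bottom top parity →
  ∑ (λ x → ∑ (λ y → χ (layerSeed bottom top parity (x , y))) (allFin 3)) (allFin 3) ≡ 2 + 2 * χ bottom + χ top
layerSeed-size true  true  _     = refl
layerSeed-size true  false _     = refl
layerSeed-size false true  _     = refl
layerSeed-size false false true  = refl
layerSeed-size false false false = refl

seed-size : ∀ n → .{{NonZero n}} → size (seed n) ≡ 2 * n + 3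
seed-size (suc m) = begin
  size (seed n)
    ≡⟨ trans (size-∑ (seed n)) (∑-vertices (χ ∘ seed n)) ⟩
  ∑ (λ x → ∑ (λ y → ∑ (λ z → f x y z) (allFin n)) (allFin 3)) (allFin 3)
    ≡⟨ ∑-cong (allFin 3) (λ x → ∑-swap (f x) (allFin 3) (allFin n)) ⟩
  ∑ (λ x → ∑ (λ z → ∑ (λ y → f x y z) (allFin 3)) (allFin n)) (allFin 3)
    ≡⟨ ∑-swap (λ x z → ∑ (λ y → f x y z) (allFin 3)) (allFin 3) (allFin n) ⟩
  ∑ (λ z → ∑ (λ x → ∑ (λ y → f x y z) (allFin 3)) (allFin 3)) (allFin n)
    ≡⟨ ∑-cong (allFin n) (λ z → layerSeed-size (toℕ z == 0) (suc (toℕ z) == n) (odd (toℕ z))) ⟩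
  ∑ (λ z → 2 + 2 * bottom z + top z) (allFin n)
    ≡⟨ trans (∑-+ (λ z → 2 + 2 * bottom z) top (allFin n)) (cong (_+ ∑ top (allFin n)) (∑-+ (λ _ → 2) (λ z → 2 * bottom z) (allFin n))) ⟩
  ∑ (λ _ → 2 * 1) (allFin n) + ∑ (λ z → 2 * bottom z) (allFin n) + ∑ top (allFin n)
    ≡⟨ cong₂ (λ a b → a + b + ∑ top (allFin n)) (∑-*ˡ 2 (λ _ → 1) (allFin n)) (∑-*ˡ 2 bottom (allFin n)) ⟩
  2 * ∑ (λ _ → 1) (allFin n) + 2 * ∑ bottom (allFin n) + ∑ top (allFin n)
    ≡⟨ cong₂ (λ a b → 2 * a + 2 * b + ∑ top (allFin n))
             (trans (∑-one (allFin n)) (length-tabulate {n = n} id)) (trans (∑-allFin-suc m bottom) (cong suc (∑-zero (allFin m)))) ⟩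
  2 * n + 2 * 1 + ∑ top (allFin n)
    ≡⟨ cong (2 * n + 2 +_) (one-top-layer m) ⟩
  2 * n + 2 + 1
    ≡⟨ +-assoc (2 * n) 2 1 ⟩
  2 * n + 3 ∎
  where
  open ≡-Reasoning
  n = suc m
  f : Fin 3 → Fin 3 → Fin n → ℕ
  f x y z = χ (seed n (x , y , z))
  bottom top : Fin n → ℕ
  bottom z = χ (toℕ z == 0)
  top    z = χ (suc (toℕ z) == n)
  one-top-layer : ∀ k → ∑ (λ (z : Fin (suc k)) → χ (suc (toℕ z) == suc k)) (allFin (suc k)) ≡ 1
  one-top-layer zero    = refl
  one-top-layer (suc k) = trans (∑-allFin-suc (suc k) (λ z → χ (suc (toℕ z) == suc (suc k)))) (one-top-layer k)

side : Bool → Fin 3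
side false = lo
side true  = hi

centre : Position
centre = mid , mid

corner : Bool → Bool → Position
corner s t = side s , side t

sideMiddle : Bool → Bool → Position
sideMiddle true  s = side s , mid
sideMiddle false t = mid , side t

besideCorner : Bool → Bool → Bool → Position
besideCorner true  s u = corner s u
besideCorner false s u = corner u s

-- Adjacency within a layer, read off in the one-layer grid; a record, so that P and Q can be inferred.
record Adjacent (P Q : Position) : Set where
  constructor adjacent
  field adjacentInLayer : adj (_at_ {1} P lo) (Q at lo) ≡ true

Adjacent-sym : ∀ {P Q} → Adjacent P Q → Adjacent Q P
Adjacent-sym {P} {Q} (adjacent PQ) = adjacent (trans (adj-sym (_at_ {1} Q lo) (P at lo)) PQ)

sideMiddle-centre : ∀ b s → Adjacent (sideMiddle b s) centre
sideMiddle-centre true  false = adjacent refl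
sideMiddle-centre true  true  = adjacent refl
sideMiddle-centre false false = adjacent refl
sideMiddle-centre false true  = adjacent refl

besideCorner-sideMiddle : ∀ b s u → Adjacent (besideCorner b s u) (sideMiddle b s)
besideCorner-sideMiddle true  false false = adjacent refl
besideCorner-sideMiddle true  false true  = adjacent refl
besideCorner-sideMiddle true  true  false = adjacent refl
besideCorner-sideMiddle true  true  true  = adjacent refl
besideCorner-sideMiddle false false false = adjacent refl
besideCorner-sideMiddle false false true  = adjacent refl
besideCorner-sideMiddle false true  false = adjacent refl
besideCorner-sideMiddle false true  true  = adjacent refl

side≢mid : ∀ s → side s ≢ mid
side≢mid false ()
side≢mid true  ()

lo≢hi : side false ≢ side true
lo≢hi ()

corner≢centre : ∀ s t → corner s t ≢ centre
corner≢centre s t = side≢mid s ∘ cong proj₁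

besideCorner≢centre : ∀ b s u → besideCorner b s u ≢ centre
besideCorner≢centre true  s u = corner≢centre s u
besideCorner≢centre false s u = corner≢centre u s

sideMiddle≢centre : ∀ b s → sideMiddle b s ≢ centre
sideMiddle≢centre true  s = side≢mid s ∘ cong proj₁
sideMiddle≢centre false s = side≢mid s ∘ cong proj₂

sideMiddles≢ : ∀ b → sideMiddle b false ≢ sideMiddle b true
sideMiddles≢ true  = lo≢hi ∘ cong proj₁
sideMiddles≢ false = lo≢hi ∘ cong proj₂

sideMiddle-true≢false : ∀ s t → sideMiddle true s ≢ sideMiddle false t
sideMiddle-true≢false s t = side≢mid s ∘ cong proj₁

besideCorners≢ : ∀ b s → besideCorner b s false ≢ besideCorner b s true
besideCorners≢ true  s = lo≢hi ∘ cong proj₂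
besideCorners≢ false s = lo≢hi ∘ cong proj₁

∣n-1+n∣≡1 : ∀ n → ∣ n - suc n ∣ ≡ 1
∣n-1+n∣≡1 zero    = refl
∣n-1+n∣≡1 (suc n) = ∣n-1+n∣≡1 n

module SeedInfection (n : ℕ) where

  open Infection (seed n)

  cell : Position → (k : ℕ) → k < n → Vertex 3 3 n
  cell P k k<n = P at fromℕ< k<n

  -- A record for the same reason as Adjacent.
  record InfectedAt (P : Position) (k : ℕ) : Set where
    constructor infectedAt
    field infected : (k<n : k < n) → Infected (cell P k k<n)

  LayerInfected : ℕ → Set
  LayerInfected k = ∀ P → InfectedAt P k

  seeded-at : ∀ {P k} → layerSeed (k == 0) (suc k == n) (odd k) P ≡ true → InfectedAt P k
  seeded-at {x , y} {k} inSeed = infectedAt λ k<n →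
    seeded (subst (λ j → layerSeed (j == 0) (suc j == n) (odd j) (x , y) ≡ true) (sym (toℕ-fromℕ< k<n)) inSeed)

  horizontal : ∀ P Q {k} (k<n : k < n) → Adjacent P Q → adj (cell P k k<n) (cell Q k k<n) ≡ true
  horizontal (x , y) (x′ , y′) k<n (adjacent PQ) rewrite ∣n-n∣≡0 (toℕ (fromℕ< k<n)) = PQ

  vertical : ∀ P {j k} (j<n : j < n) (k<n : k < n) → ∣ j - k ∣ ≡ 1 → adj (cell P j j<n) (cell P k k<n) ≡ true
  vertical (x , y) j<n k<n jk
    rewrite ∣n-n∣≡0 (toℕ x) | ∣n-n∣≡0 (toℕ y) | toℕ-fromℕ< j<n | toℕ-fromℕ< k<n | jk = refl

  positions-≢ : ∀ P Q {k} (k<n : k < n) → P ≢ Q → cell P k k<n ≢ cell Q k k<n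
  positions-≢ P Q k<n P≢Q eq = P≢Q (cong (λ v → proj₁ v , proj₁ (proj₂ v)) eq)

  layers-≢ : ∀ P Q {j k} (j<n : j < n) (k<n : k < n) → j ≢ k → cell P j j<n ≢ cell Q k k<n
  layers-≢ P Q j<n k<n j≢k eq =
    j≢k (trans (sym (toℕ-fromℕ< j<n)) (trans (cong (toℕ ∘ proj₂ ∘ proj₂) eq) (toℕ-fromℕ< k<n)))

  three-beside : ∀ {P Q R S k} → Adjacent Q P → Adjacent R P → Adjacent S P → Q ≢ R → Q ≢ S → R ≢ S →
                 InfectedAt Q k → InfectedAt R k → InfectedAt S k → InfectedAt P k
  three-beside {P} {Q} {R} {S} QP RP SP Q≢R Q≢S R≢S (infectedAt Q↑) (infectedAt R↑) (infectedAt S↑) = infectedAt λ k<n →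
    three-neighbours (horizontal Q P k<n QP) (horizontal R P k<n RP) (horizontal S P k<n SP)
                     (positions-≢ Q R k<n Q≢R) (positions-≢ Q S k<n Q≢S) (positions-≢ R S k<n R≢S) (Q↑ k<n) (R↑ k<n) (S↑ k<n)

  two-beside-above : ∀ {P Q R k} → suc k < n → Adjacent Q P → Adjacent R P → Q ≢ R →
                     InfectedAt Q k → InfectedAt R k → InfectedAt P (suc k) → InfectedAt P k
  two-beside-above {P} {Q} {R} {k} k+1<n QP RP Q≢R (infectedAt Q↑) (infectedAt R↑) (infectedAt P↑) = infectedAt λ k<n →
    three-neighbours (horizontal Q P k<n QP) (horizontal R P k<n RP)
                     (vertical P k+1<n k<n (trans (∣-∣-comm (suc k) k) (∣n-1+n∣≡1 k)))
                     (positions-≢ Q R k<n Q≢R) (layers-≢ Q P k<n k+1<n (1+n≢n ∘ sym)) (layers-≢ R P k<n k+1<n (1+n≢n ∘ sym))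
                     (Q↑ k<n) (R↑ k<n) (P↑ k+1<n)

  two-beside-below : ∀ {P Q R k} → Adjacent Q P → Adjacent R P → Q ≢ R →
                     InfectedAt Q (suc k) → InfectedAt R (suc k) → InfectedAt P k → InfectedAt P (suc k)
  two-beside-below {P} {Q} {R} {k} QP RP Q≢R (infectedAt Q↑) (infectedAt R↑) (infectedAt P↑) = infectedAt λ k+1<n →
    let k<n = <⇒≤ k+1<n in
    three-neighbours (horizontal Q P k+1<n QP) (horizontal R P k+1<n RP) (vertical P k<n k+1<n (∣n-1+n∣≡1 k))
                     (positions-≢ Q R k+1<n Q≢R) (layers-≢ Q P k+1<n k<n 1+n≢n) (layers-≢ R P k+1<n k<n 1+n≢n)
                     (Q↑ k+1<n) (R↑ k+1<n) (P↑ k<n)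

  beside-below-above : ∀ {P Q k} → suc (suc k) < n → Adjacent Q P →
                       InfectedAt Q (suc k) → InfectedAt P k → InfectedAt P (suc (suc k)) → InfectedAt P (suc k)
  beside-below-above {P} {Q} {k} k+2<n QP (infectedAt Q↑) (infectedAt P↑) (infectedAt P↑↑) = infectedAt λ k+1<n →
    let k<n = <⇒≤ k+1<n in
    three-neighbours (horizontal Q P k+1<n QP) (vertical P k<n k+1<n (∣n-1+n∣≡1 k))
                     (vertical P k+2<n k+1<n (trans (∣-∣-comm (suc (suc k)) (suc k)) (∣n-1+n∣≡1 (suc k))))
                     (layers-≢ Q P k+1<n k<n 1+n≢n) (layers-≢ Q P k+1<n k+2<n (1+n≢n ∘ sym)) (layers-≢ P P k<n k+2<n (m≢1+n+m k {1}))
                     (Q↑ k+1<n) (P↑ k<n) (P↑↑ k+2<n)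

  layer-from-parts : ∀ {k} → InfectedAt centre k → (∀ b s → InfectedAt (sideMiddle b s) k) →
                     (∀ s t → InfectedAt (corner s t) k) → LayerInfected k
  layer-from-parts centre↑ middle↑ corner↑ (lo  , lo)  = corner↑ false false
  layer-from-parts centre↑ middle↑ corner↑ (lo  , mid) = middle↑ true false
  layer-from-parts centre↑ middle↑ corner↑ (lo  , hi)  = corner↑ false true
  layer-from-parts centre↑ middle↑ corner↑ (mid , lo)  = middle↑ false false
  layer-from-parts centre↑ middle↑ corner↑ (mid , mid) = centre↑
  layer-from-parts centre↑ middle↑ corner↑ (mid , hi)  = middle↑ false true
  layer-from-parts centre↑ middle↑ corner↑ (hi  , lo)  = corner↑ true false
  layer-from-parts centre↑ middle↑ corner↑ (hi  , mid) = middle↑ true true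
  layer-from-parts centre↑ middle↑ corner↑ (hi  , hi)  = corner↑ true true

  bottom-corner : ∀ s t → InfectedAt (corner s t) 0
  bottom-corner false false = seeded-at refl
  bottom-corner false true  = seeded-at refl
  bottom-corner true  false = seeded-at refl
  bottom-corner true  true  = seeded-at refl

  bottom-besideCorner : ∀ b s u → InfectedAt (besideCorner b s u) 0
  bottom-besideCorner true  s u = bottom-corner s u
  bottom-besideCorner false s u = bottom-corner u s

  sideMiddle-from-corners : ∀ {k} b s → InfectedAt (besideCorner b s false) k → InfectedAt (besideCorner b s true) k →
                            InfectedAt centre k → InfectedAt (sideMiddle b s) k
  sideMiddle-from-corners b s =
    three-beside (besideCorner-sideMiddle b s false) (besideCorner-sideMiddle b s true) (Adjacent-sym (sideMiddle-centre b s))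
                 (besideCorners≢ b s) (besideCorner≢centre b s false) (besideCorner≢centre b s true)

  corner-from-sideMiddles : ∀ {k} s t → InfectedAt (sideMiddle true s) (suc k) → InfectedAt (sideMiddle false t) (suc k) →
                            InfectedAt (corner s t) k → InfectedAt (corner s t) (suc k)
  corner-from-sideMiddles s t =
    two-beside-below (Adjacent-sym (besideCorner-sideMiddle true s t)) (Adjacent-sym (besideCorner-sideMiddle false t s))
                     (sideMiddle-true≢false s t)

==-refl : ∀ a → (a == a) ≡ true
==-refl a = Equivalence.to T-≡ (≡⇒≡ᵇ a a refl)

<⇒==-false : ∀ {a b} → a < b → (a == b) ≡ false
<⇒==-false {a} {b} a<b with a == b in eq
... | false = refl
... | true  = contradiction (≡ᵇ⇒≡ a b (Equivalence.from T-≡ eq)) (<⇒≢ a<b)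

parity-cases : ∀ c b → c ≡ b ⊎ c ≡ not b
parity-cases false false = inj₁ refl
parity-cases false true  = inj₂ refl
parity-cases true  false = inj₂ refl
parity-cases true  true  = inj₁ refl

isDiagonal-corner : ∀ s → isDiagonal (corner s s) ≡ true
isDiagonal-corner false = refl
isDiagonal-corner true  = refl

isSideMiddle-sideMiddle : ∀ b s → isSideMiddle b (sideMiddle b s) ≡ true
isSideMiddle-sideMiddle true  false = refl
isSideMiddle-sideMiddle true  true  = refl
isSideMiddle-sideMiddle false false = refl
isSideMiddle-sideMiddle false true  = refl

sideMiddle-diagonalCorner : ∀ b s → Adjacent (sideMiddle b s) (corner s s)
sideMiddle-diagonalCorner true  s = Adjacent-sym (besideCorner-sideMiddle true s s)
sideMiddle-diagonalCorner false s = Adjacent-sym (besideCorner-sideMiddle false s s)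

module ThreeOrMoreLayers (m : ℕ) where

  top : ℕ
  top = suc (suc m)

  open SeedInfection (suc top)

  sideMiddle-seed : ∀ j → suc (suc j) < suc top → ∀ s → InfectedAt (sideMiddle (odd (suc j)) s) (suc j)
  sideMiddle-seed j j+2<n s = seeded-at (trans (cong (λ t → layerSeed false t (odd (suc j)) (sideMiddle (odd (suc j)) s))
                                                     (<⇒==-false j+2<n))
                                              (isSideMiddle-sideMiddle (odd (suc j)) s))

  diagonal-seed : ∀ {P} → isDiagonal P ≡ true → InfectedAt P top
  diagonal-seed {P} diagonal = seeded-at (trans (cong (λ t → layerSeed false t (odd top) P) (==-refl m)) diagonal)

  bottom-sideMiddle : ∀ s → InfectedAt (sideMiddle true s) 0
  bottom-sideMiddle s =
    two-beside-above (s≤s (s≤s z≤n)) (besideCorner-sideMiddle true s false) (besideCorner-sideMiddle true s true)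
                     (besideCorners≢ true s) (bottom-corner s false) (bottom-corner s true) (sideMiddle-seed 0 (s≤s (s≤s (s≤s z≤n))) s)

  centre-below : ∀ k → suc k < suc top → InfectedAt centre (suc k) → InfectedAt centre k
  centre-below zero    1<n =
    two-beside-above 1<n (sideMiddle-centre true false) (sideMiddle-centre true true) (sideMiddles≢ true)
                     (bottom-sideMiddle false) (bottom-sideMiddle true)
  centre-below (suc j) j+2<n =
    two-beside-above j+2<n (sideMiddle-centre b false) (sideMiddle-centre b true) (sideMiddles≢ b)
                     (sideMiddle-seed j j+2<n false) (sideMiddle-seed j j+2<n true)
    where b = odd (suc j)

  centre-column : ∀ d k → k + d ≡ top → InfectedAt centre k
  centre-column zero    k k≡top rewrite +-identityʳ k | k≡top = diagonal-seed refl
  centre-column (suc d) k k+d+1≡top = centre-below k (s≤s k+1≤top) (centre-column d (suc k) k+1+d≡top)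
    where
    k+1+d≡top : suc k + d ≡ top
    k+1+d≡top = trans (sym (+-suc k d)) k+d+1≡top
    k+1≤top : suc k ≤ top
    k+1≤top = subst (suc k ≤_) k+1+d≡top (m≤m+n (suc k) d)

  centre-infected : ∀ k → InfectedAt centre k
  centre-infected k = infectedAt λ k<n →
    InfectedAt.infected (centre-column (top ∸ k) k (m+[n∸m]≡n (≤-pred k<n))) k<n

  bottom-layer : LayerInfected 0
  bottom-layer = layer-from-parts (centre-infected 0) middle↑ bottom-corner
    where
    middle↑ : ∀ b s → InfectedAt (sideMiddle b s) 0
    middle↑ true  s = bottom-sideMiddle s
    middle↑ false s = sideMiddle-from-corners false s (bottom-corner false s) (bottom-corner true s) (centre-infected 0)

  -- In layers 1, …, top − 2 the seeds of the layer above complete the side middles.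
  middle-layer : ∀ j → suc (suc (suc j)) < suc top → LayerInfected j → LayerInfected (suc j)
  middle-layer j j+3<n below = layer-from-parts (centre-infected (suc j)) middle↑ corner↑
    where
    middle↑ : ∀ c s → InfectedAt (sideMiddle c s) (suc j)
    middle↑ c s with parity-cases c (odd (suc j))
    ... | inj₁ refl = sideMiddle-seed j (<⇒≤ j+3<n) s
    ... | inj₂ refl = beside-below-above (<⇒≤ j+3<n) (Adjacent-sym (sideMiddle-centre c s))
                                         (centre-infected (suc j)) (below (sideMiddle c s)) (sideMiddle-seed (suc j) j+3<n s)
    corner↑ : ∀ s t → InfectedAt (corner s t) (suc j)
    corner↑ s t = corner-from-sideMiddles s t (middle↑ true s) (middle↑ false t) (below (corner s t))

  -- In layer top − 1 the diagonal seeds of the top layer complete the diagonal corners first.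
  penultimate-layer : LayerInfected m → LayerInfected (suc m)
  penultimate-layer below = layer-from-parts (centre-infected (suc m)) middle↑ corner↑
    where
    b = odd (suc m)
    diagonal↑ : ∀ s → InfectedAt (corner s s) (suc m)
    diagonal↑ s = beside-below-above ≤-refl (sideMiddle-diagonalCorner b s) (sideMiddle-seed m ≤-refl s)
                                     (below (corner s s)) (diagonal-seed (isDiagonal-corner s))
    middle↑ : ∀ c s → InfectedAt (sideMiddle c s) (suc m)
    middle↑ c s with parity-cases c b
    ... | inj₁ refl = sideMiddle-seed m ≤-refl s
    ... | inj₂ refl = two-beside-below (Adjacent-sym (sideMiddle-centre c s)) (Adjacent-sym (sideMiddle-diagonalCorner c s))
                                       (corner≢centre s s ∘ sym) (centre-infected (suc m)) (diagonal↑ s) (below (sideMiddle c s))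
    corner↑ : ∀ s t → InfectedAt (corner s t) (suc m)
    corner↑ false false = diagonal↑ false
    corner↑ true  true  = diagonal↑ true
    corner↑ false true  = corner-from-sideMiddles false true (middle↑ true false) (middle↑ false true) (below (corner false true))
    corner↑ true  false = corner-from-sideMiddles true false (middle↑ true true) (middle↑ false false) (below (corner true false))

  top-layer : LayerInfected (suc m) → LayerInfected top
  top-layer below = layer-from-parts (centre-infected top) middle↑ corner↑
    where
    diagonal↑ : ∀ s → InfectedAt (corner s s) top
    diagonal↑ s = diagonal-seed (isDiagonal-corner s)
    middle↑ : ∀ c s → InfectedAt (sideMiddle c s) top
    middle↑ c s = two-beside-below (Adjacent-sym (sideMiddle-diagonalCorner c s)) (Adjacent-sym (sideMiddle-centre c s))
                                   (corner≢centre s s) (diagonal↑ s) (centre-infected top) (below (sideMiddle c s))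
    corner↑ : ∀ s t → InfectedAt (corner s t) top
    corner↑ false false = diagonal↑ false
    corner↑ true  true  = diagonal↑ true
    corner↑ false true  = corner-from-sideMiddles false true (middle↑ true false) (middle↑ false true) (below (corner false true))
    corner↑ true  false = corner-from-sideMiddles true false (middle↑ true true) (middle↑ false false) (below (corner true false))

  layers : ∀ k → k ≤ top → LayerInfected k
  layers zero    _        = bottom-layer
  layers (suc j) j+1≤top with m≤n⇒m<n∨m≡n j+1≤top
  ... | inj₂ refl = top-layer (layers (suc m) (n≤1+n (suc m)))
  ... | inj₁ (s≤s j+1≤m+1) with m≤n⇒m<n∨m≡n j+1≤m+1
  ...   | inj₂ refl    = penultimate-layer (layers m (≤-trans (n≤1+n m) (n≤1+n (suc m))))
  ...   | inj₁ j+2≤m+1 = middle-layer j (s≤s (s≤s j+2≤m+1)) (layers j (≤-trans (n≤1+n j) (≤-trans j+1≤m+1 (n≤1+n (suc m)))))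

  percolates : Percolates (seed (suc top))
  percolates (x , y , z) = subst (λ w → Infected (x , y , w)) (fromℕ<-toℕ z (toℕ<n z))
    (InfectedAt.infected (layers (toℕ z) (≤-pred (toℕ<n z)) (x , y)) (toℕ<n z))
    where open Infection (seed (suc top))

module OneLayer where

  open SeedInfection 1

  single-layer : LayerInfected 0
  single-layer = layer-from-parts centre↑ middle↑ bottom-corner
    where
    centre↑ : InfectedAt centre 0
    centre↑ = seeded-at refl
    middle↑ : ∀ b s → InfectedAt (sideMiddle b s) 0
    middle↑ b s = sideMiddle-from-corners b s (bottom-besideCorner b s false) (bottom-besideCorner b s true) centre↑

  percolates : Percolates (seed 1)
  percolates (x , y , lo) = InfectedAt.infected (single-layer (x , y)) (s≤s z≤n)

seed-percolates : ∀ n → .{{NonZero n}} → n ≢ 2 → Percolates (seed n)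
seed-percolates 1                   _   = OneLayer.percolates
seed-percolates 2                   2≢2 = contradiction refl 2≢2
seed-percolates (suc (suc (suc m))) _   = ThreeOrMoreLayers.percolates m

perfect-3×3 : ∀ n → .{{NonZero n}} → Percolates (seed n) → Perfect 3 3 n
perfect-3×3 n perc =
  subst (λ s → s % 3 ≡ 0) (trans (*-comm (2 * n + 3) 3) 3k≡σ₂) (m*n%n≡0 (2 * n + 3) 3) ,
  2 * n + 3 , 3k≡σ₂ , (seed n , perc , seed-size n) , λ A percA → percolating-size-bound percA 3k≡σ₂
  where
  3k≡σ₂ : 3 * (2 * n + 3) ≡ σ₂ 3 3 n
  3k≡σ₂ = expand n
    where
    expand : ∀ n → 3 * (2 * n + 3) ≡ 3 * 3 + 3 * n + 3 * n
    expand = solve-∀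

corollary5p14 : (a₃ : ℕ) → 1 ≤ a₃ → (Perfect 3 3 a₃ ⇔ a₃ ≢ 2)
corollary5p14 a₃@(suc _) _ = mk⇔ not-two (λ a₃≢2 → perfect-3×3 a₃ (seed-percolates a₃ a₃≢2))
  where
  not-two : Perfect 3 3 a₃ → a₃ ≢ 2
  not-two (_ , k , 3k≡21 , (A , perc , size≡k) , _) refl =
    <-irrefl refl (subst (8 ≤_) (trans size≡k (*-cancelˡ-≡ k 7 3 3k≡21)) (percolating-3×3×2 perc))
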